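{- Let $\mathbf{Q}$ be a flat QB-algebra and let $x,y\in\mathscr{IR}(Q)$ with $x\neq y$. Let $\Delta=\{\langle a,a\rangle:a\in Q\}$ and define $\theta_{x,y}$ as follows: if $x=x^{*}$ and $y=y^{*}$, $\theta_{x,y}=\Delta\cup\{\langle x,y\rangle,\langle y,x\rangle\}$; if $x=x^{*}$ and $y\neq y^{*}$, $\theta_{x,y}=\Delta\cup\{\langle x,y\rangle,\langle y,x\rangle,\langle x^{*},y^{*}\rangle,\langle y^{*},x^{*}\rangle,\langle y,y^{*}\rangle,\langle y^{*},y\rangle\}$; if $x\neq x^{*}$ and $y=y^{*}$, $\theta_{x,y}=\Delta\cup\{\langle x,y\rangle,\langle y,x\rangle,\langle x^{*},y^{*}\rangle,\langle y^{*},x^{*}\rangle,\langle x,x^{*}\rangle,\langle x^{*},x\rangle\}$; if $x\neq x^{*}$ and $y\neq y^{*}$, $\theta_{x,y}=\Delta\cup\{\langle x,y\rangle,\langle y,x\rangle,\langle x^{*},y^{*}\rangle,\langle y^{*},x^{*}\rangle,\langle x,x^{*}\rangle,\langle x^{*},x\rangle,\langle y,y^{*}\rangle,\langle y^{*},y\rangle,\langle x,y^{*}\rangle,\langle y^{*},x\rangle,\langle x^{*},y\rangle,\langle y,x^{*}\rangle\}$. Then $\theta_{x,y}$ is a congruence on $\mathbf{Q}$.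
   Context: A quasi-lattice is an algebra $\langle L;\vee,\wedge\rangle$ such that for all $x,y,z$: $\vee,\wedge$ are commutative and associative; $x\vee(x\wedge y)=x\vee x$ and $x\wedge(x\vee y)=x\wedge x$; $x\vee(y\vee y)=x\vee y$ and $x\wedge(y\wedge y)=x\wedge y$; $x\vee x=x\wedge x$; distributive if both distributive laws hold. A QB-algebra is an algebra $\langle Q;\vee,\wedge,{}^{*},0,1\rangle$ of type $\langle 2,2,1,0,0\rangle$ such that $\langle Q;\vee,\wedge\rangle$ is a distributive quasi-lattice and for all $x$: $x\vee 1=1$, $x\wedge 0=0$, $x\vee x^{*}=1$, $x\wedge x^{*}=0$, $(x\wedge x)^{*}=x^{*}\vee x^{*}$, $x^{**}=x$. A QB-algebra is flat if $1=0$. An element $x$ is regular if $x\vee x=x$; $\mathscr{IR}(Q)$ is the set of non-regular (irregular) elements. -}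

module Defs where

open import Level using (Level; _⊔_; suc)
open import Data.Product using (_×_; _,_)
open import Data.Sum using (_⊎_)
open import Relation.Binary.PropositionalEquality using (_≡_)
open import Relation.Nullary using (¬_)
open import Relation.Binary.Definitions using (Reflexive; Symmetric; Transitive)

record QBAlgebra (a : Level) : Set (suc a) where
  infixr 6 _∨_
  infixr 7 _∧_
  field
    Carrier : Set a
    _∨_ _∧_ : Carrier → Carrier → Carrier
    _*      : Carrier → Carrier
    𝟘 𝟙     : Carrier
    ∨-comm  : ∀ x y → x ∨ y ≡ y ∨ x
    ∧-comm  : ∀ x y → x ∧ y ≡ y ∧ x
    ∨-assoc : ∀ x y z → (x ∨ y) ∨ z ≡ x ∨ (y ∨ z)
    ∧-assoc : ∀ x y z → (x ∧ y) ∧ z ≡ x ∧ (y ∧ z)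
    ∨-absorb : ∀ x y → x ∨ (x ∧ y) ≡ x ∨ x
    ∧-absorb : ∀ x y → x ∧ (x ∨ y) ≡ x ∧ x
    ∨-idem-r : ∀ x y → x ∨ (y ∨ y) ≡ x ∨ y
    ∧-idem-r : ∀ x y → x ∧ (y ∧ y) ≡ x ∧ y
    ∨x≡∧x    : ∀ x → x ∨ x ≡ x ∧ x
    ∧-distrib-∨ : ∀ x y z → x ∧ (y ∨ z) ≡ (x ∧ y) ∨ (x ∧ z)
    ∨-distrib-∧ : ∀ x y z → x ∨ (y ∧ z) ≡ (x ∨ y) ∧ (x ∨ z)
    ∨-one   : ∀ x → x ∨ 𝟙 ≡ 𝟙
    ∧-zero  : ∀ x → x ∧ 𝟘 ≡ 𝟘
    ∨-compl : ∀ x → x ∨ (x *) ≡ 𝟙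
    ∧-compl : ∀ x → x ∧ (x *) ≡ 𝟘
    *-∧     : ∀ x → (x ∧ x) * ≡ (x *) ∨ (x *)
    *-invol : ∀ x → (x *) * ≡ x

module _ {a : Level} (Q : QBAlgebra a) where
  open QBAlgebra Q

  Flat : Set a
  Flat = 𝟙 ≡ 𝟘

  Irregular : Carrier → Set a
  Irregular x = ¬ (x ∨ x ≡ x)

  record IsCongruence (θ : Carrier → Carrier → Set a) : Set a where
    field
      refl  : Reflexive θ
      sym   : Symmetric θ
      trans : Transitive θ
      ∨-cong : ∀ {a b c d} → θ a b → θ c d → θ (a ∨ c) (b ∨ d)
      ∧-cong : ∀ {a b c d} → θ a b → θ c d → θ (a ∧ c) (b ∧ d)
      *-cong : ∀ {a b} → θ a b → θ (a *) (b *)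

  Pair± : Carrier → Carrier → Carrier → Carrier → Set a
  Pair± u v a b = (a ≡ u × b ≡ v) ⊎ (a ≡ v × b ≡ u)

  θ₁ θ₂ θ₃ θ₄ : Carrier → Carrier → Carrier → Carrier → Set a
  θ₁ x y a b = a ≡ b ⊎ Pair± x y a b
  θ₂ x y a b = a ≡ b ⊎ Pair± x y a b ⊎ Pair± (x *) (y *) a b ⊎ Pair± y (y *) a b
  θ₃ x y a b = a ≡ b ⊎ Pair± x y a b ⊎ Pair± (x *) (y *) a b ⊎ Pair± x (x *) a b
  θ₄ x y a b = a ≡ b ⊎ Pair± x y a b ⊎ Pair± (x *) (y *) a b ⊎ Pair± x (x *) a b
                 ⊎ Pair± y (y *) a b ⊎ Pair± x (y *) a b ⊎ Pair± (x *) y a b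

module Submission where

open import Defs
open import Level using (Level)
open import Data.Product using (_×_; _,_)
open import Data.Sum using (_⊎_; inj₁; inj₂)
open import Relation.Binary.PropositionalEquality
  using (_≡_; _≢_; refl; sym; trans; cong; module ≡-Reasoning)

-- In a flat QB-algebra every regular element equals 1 = 0, and every join and
-- meet is regular, so ∨ and ∧ are constant.  Hence an equivalence relation is
-- a congruence as soon as it respects *, and each θ_{x,y} is the equivalence
-- whose only non-singleton block is a *-closed set ({x, y}, {x, y, y*},
-- {x, x*, y} or {x, x*, y, y*}).

module _ {a : Level} {A : Set a} (_∙_ : A → A → A)
         (comm : ∀ x y → x ∙ y ≡ y ∙ x)
         (assoc : ∀ x y z → (x ∙ y) ∙ z ≡ x ∙ (y ∙ z))
         (idem-r : ∀ x y → x ∙ (y ∙ y) ≡ x ∙ y) where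
  open ≡-Reasoning

  square-idempotent : ∀ u v → (u ∙ v) ∙ (u ∙ v) ≡ u ∙ v
  square-idempotent u v = begin
    (u ∙ v) ∙ (u ∙ v)   ≡⟨ assoc u v (u ∙ v) ⟩
    u ∙ (v ∙ (u ∙ v))   ≡⟨ cong (λ t → u ∙ (v ∙ t)) (comm u v) ⟩
    u ∙ (v ∙ (v ∙ u))   ≡⟨ cong (u ∙_) (sym (assoc v v u)) ⟩
    u ∙ ((v ∙ v) ∙ u)   ≡⟨ cong (u ∙_) (comm (v ∙ v) u) ⟩
    u ∙ (u ∙ (v ∙ v))   ≡⟨ cong (u ∙_) (idem-r u v) ⟩
    u ∙ (u ∙ v)         ≡⟨ sym (assoc u u v) ⟩
    (u ∙ u) ∙ v         ≡⟨ comm (u ∙ u) v ⟩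
    v ∙ (u ∙ u)         ≡⟨ idem-r v u ⟩
    v ∙ u               ≡⟨ comm v u ⟩
    u ∙ v               ∎

module _ {ℓ : Level} (Q : QBAlgebra ℓ) where
  open QBAlgebra Q

  isCongruence-resp-⇔ : {R S : Carrier → Carrier → Set ℓ} →
                        (∀ {u v} → R u v → S u v) → (∀ {u v} → S u v → R u v) →
                        IsCongruence Q R → IsCongruence Q S
  isCongruence-resp-⇔ R⇒S S⇒R isCong = record
    { refl   = R⇒S C.refl
    ; sym    = λ s → R⇒S (C.sym (S⇒R s))
    ; trans  = λ s t → R⇒S (C.trans (S⇒R s) (S⇒R t))
    ; ∨-cong = λ s t → R⇒S (C.∨-cong (S⇒R s) (S⇒R t))
    ; ∧-cong = λ s t → R⇒S (C.∧-cong (S⇒R s) (S⇒R t))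
    ; *-cong = λ s → R⇒S (C.*-cong (S⇒R s))
    }
    where module C = IsCongruence isCong

  Block : (Carrier → Set ℓ) → Carrier → Carrier → Set ℓ
  Block S u v = u ≡ v ⊎ (S u × S v)

module Flat {ℓ : Level} (Q : QBAlgebra ℓ) (flat : Flat Q) where
  open QBAlgebra Q
  open ≡-Reasoning

  regular⇒≡𝟙 : ∀ r → r ∨ r ≡ r → r ≡ 𝟙
  regular⇒≡𝟙 r regular = begin
    r            ≡⟨ sym regular ⟩
    r ∨ r        ≡⟨ sym (∨-absorb r 𝟘) ⟩
    r ∨ (r ∧ 𝟘)  ≡⟨ cong (r ∨_) (∧-zero r) ⟩
    r ∨ 𝟘        ≡⟨ cong (r ∨_) (sym flat) ⟩
    r ∨ 𝟙        ≡⟨ ∨-one r ⟩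
    𝟙            ∎

  ∨≡𝟙 : ∀ u v → u ∨ v ≡ 𝟙
  ∨≡𝟙 u v = regular⇒≡𝟙 (u ∨ v) (square-idempotent _∨_ ∨-comm ∨-assoc ∨-idem-r u v)

  ∧≡𝟙 : ∀ u v → u ∧ v ≡ 𝟙
  ∧≡𝟙 u v = regular⇒≡𝟙 (u ∧ v)
    (trans (∨x≡∧x (u ∧ v)) (square-idempotent _∧_ ∧-comm ∧-assoc ∧-idem-r u v))

  Block-isCongruence : (S : Carrier → Set ℓ) → (∀ {u} → S u → S (u *)) →
                       IsCongruence Q (Block Q S)
  Block-isCongruence S *-closed = record
    { refl   = inj₁ refl
    ; sym    = Block-sym
    ; trans  = Block-trans
    ; ∨-cong = λ {u} {v} {w} {z} _ _ → inj₁ (trans (∨≡𝟙 u w) (sym (∨≡𝟙 v z)))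
    ; ∧-cong = λ {u} {v} {w} {z} _ _ → inj₁ (trans (∧≡𝟙 u w) (sym (∧≡𝟙 v z)))
    ; *-cong = Block-*
    }
    where
    Block-sym : ∀ {u v} → Block Q S u v → Block Q S v u
    Block-sym (inj₁ refl)      = inj₁ refl
    Block-sym (inj₂ (su , sv)) = inj₂ (sv , su)

    Block-trans : ∀ {u v w} → Block Q S u v → Block Q S v w → Block Q S u w
    Block-trans (inj₁ refl)     b                = b
    Block-trans (inj₂ p)        (inj₁ refl)      = inj₂ p
    Block-trans (inj₂ (su , _)) (inj₂ (_ , sw))  = inj₂ (su , sw)

    Block-* : ∀ {u v} → Block Q S u v → Block Q S (u *) (v *)
    Block-* (inj₁ refl)      = inj₁ refl
    Block-* (inj₂ (su , sv)) = inj₂ (*-closed su , *-closed sv)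

module Theta {ℓ : Level} (Q : QBAlgebra ℓ) (flat : Flat Q) (x y : QBAlgebra.Carrier Q) where
  open QBAlgebra Q
  open Flat Q flat

  θ₁-isCongruence : x ≡ x * → y ≡ y * → IsCongruence Q (θ₁ Q x y)
  θ₁-isCongruence x≡x* y≡y* =
    isCongruence-resp-⇔ Q block⇒θ₁ θ₁⇒block (Block-isCongruence S *-closed)
    where
    S : Carrier → Set ℓ
    S u = u ≡ x ⊎ u ≡ y

    *-closed : ∀ {u} → S u → S (u *)
    *-closed (inj₁ refl) = inj₁ (sym x≡x*)
    *-closed (inj₂ refl) = inj₂ (sym y≡y*)

    θ₁⇒block : ∀ {u v} → θ₁ Q x y u v → Block Q S u v
    θ₁⇒block (inj₁ e)               = inj₁ e
    θ₁⇒block (inj₂ (inj₁ (p , q))) = inj₂ (inj₁ p , inj₂ q)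
    θ₁⇒block (inj₂ (inj₂ (p , q))) = inj₂ (inj₂ p , inj₁ q)

    block⇒θ₁ : ∀ {u v} → Block Q S u v → θ₁ Q x y u v
    block⇒θ₁ (inj₁ e)                     = inj₁ e
    block⇒θ₁ (inj₂ (inj₁ refl , inj₁ refl)) = inj₁ refl
    block⇒θ₁ (inj₂ (inj₁ refl , inj₂ refl)) = inj₂ (inj₁ (refl , refl))
    block⇒θ₁ (inj₂ (inj₂ refl , inj₁ refl)) = inj₂ (inj₂ (refl , refl))
    block⇒θ₁ (inj₂ (inj₂ refl , inj₂ refl)) = inj₁ refl

  θ₂-isCongruence : x ≡ x * → IsCongruence Q (θ₂ Q x y)
  θ₂-isCongruence x≡x* =
    isCongruence-resp-⇔ Q block⇒θ₂ θ₂⇒block (Block-isCongruence S *-closed)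
    where
    S : Carrier → Set ℓ
    S u = u ≡ x ⊎ u ≡ y ⊎ u ≡ y *

    *-closed : ∀ {u} → S u → S (u *)
    *-closed (inj₁ refl)        = inj₁ (sym x≡x*)
    *-closed (inj₂ (inj₁ refl)) = inj₂ (inj₂ refl)
    *-closed (inj₂ (inj₂ refl)) = inj₂ (inj₁ (*-invol y))

    θ₂⇒block : ∀ {u v} → θ₂ Q x y u v → Block Q S u v
    θ₂⇒block (inj₁ e)                               = inj₁ e
    θ₂⇒block (inj₂ (inj₁ (inj₁ (p , q))))           = inj₂ (inj₁ p , inj₂ (inj₁ q))
    θ₂⇒block (inj₂ (inj₁ (inj₂ (p , q))))           = inj₂ (inj₂ (inj₁ p) , inj₁ q)
    θ₂⇒block (inj₂ (inj₂ (inj₁ (inj₁ (p , q)))))    = inj₂ (inj₁ (trans p (sym x≡x*)) , inj₂ (inj₂ q))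
    θ₂⇒block (inj₂ (inj₂ (inj₁ (inj₂ (p , q)))))    = inj₂ (inj₂ (inj₂ p) , inj₁ (trans q (sym x≡x*)))
    θ₂⇒block (inj₂ (inj₂ (inj₂ (inj₁ (p , q)))))    = inj₂ (inj₂ (inj₁ p) , inj₂ (inj₂ q))
    θ₂⇒block (inj₂ (inj₂ (inj₂ (inj₂ (p , q)))))    = inj₂ (inj₂ (inj₂ p) , inj₂ (inj₁ q))

    block⇒θ₂ : ∀ {u v} → Block Q S u v → θ₂ Q x y u v
    block⇒θ₂ (inj₁ e)                                           = inj₁ e
    block⇒θ₂ (inj₂ (inj₁ refl        , inj₁ refl))              = inj₁ refl
    block⇒θ₂ (inj₂ (inj₁ refl        , inj₂ (inj₁ refl)))       = inj₂ (inj₁ (inj₁ (refl , refl)))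
    block⇒θ₂ (inj₂ (inj₁ refl        , inj₂ (inj₂ refl)))       = inj₂ (inj₂ (inj₁ (inj₁ (x≡x* , refl))))
    block⇒θ₂ (inj₂ (inj₂ (inj₁ refl) , inj₁ refl))              = inj₂ (inj₁ (inj₂ (refl , refl)))
    block⇒θ₂ (inj₂ (inj₂ (inj₁ refl) , inj₂ (inj₁ refl)))       = inj₁ refl
    block⇒θ₂ (inj₂ (inj₂ (inj₁ refl) , inj₂ (inj₂ refl)))       = inj₂ (inj₂ (inj₂ (inj₁ (refl , refl))))
    block⇒θ₂ (inj₂ (inj₂ (inj₂ refl) , inj₁ refl))              = inj₂ (inj₂ (inj₁ (inj₂ (refl , x≡x*))))
    block⇒θ₂ (inj₂ (inj₂ (inj₂ refl) , inj₂ (inj₁ refl)))       = inj₂ (inj₂ (inj₂ (inj₂ (refl , refl))))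
    block⇒θ₂ (inj₂ (inj₂ (inj₂ refl) , inj₂ (inj₂ refl)))       = inj₁ refl

  θ₃-isCongruence : y ≡ y * → IsCongruence Q (θ₃ Q x y)
  θ₃-isCongruence y≡y* =
    isCongruence-resp-⇔ Q block⇒θ₃ θ₃⇒block (Block-isCongruence S *-closed)
    where
    S : Carrier → Set ℓ
    S u = u ≡ x ⊎ u ≡ x * ⊎ u ≡ y

    *-closed : ∀ {u} → S u → S (u *)
    *-closed (inj₁ refl)        = inj₂ (inj₁ refl)
    *-closed (inj₂ (inj₁ refl)) = inj₁ (*-invol x)
    *-closed (inj₂ (inj₂ refl)) = inj₂ (inj₂ (sym y≡y*))

    θ₃⇒block : ∀ {u v} → θ₃ Q x y u v → Block Q S u v
    θ₃⇒block (inj₁ e)                               = inj₁ e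
    θ₃⇒block (inj₂ (inj₁ (inj₁ (p , q))))           = inj₂ (inj₁ p , inj₂ (inj₂ q))
    θ₃⇒block (inj₂ (inj₁ (inj₂ (p , q))))           = inj₂ (inj₂ (inj₂ p) , inj₁ q)
    θ₃⇒block (inj₂ (inj₂ (inj₁ (inj₁ (p , q)))))    = inj₂ (inj₂ (inj₁ p) , inj₂ (inj₂ (trans q (sym y≡y*))))
    θ₃⇒block (inj₂ (inj₂ (inj₁ (inj₂ (p , q)))))    = inj₂ (inj₂ (inj₂ (trans p (sym y≡y*))) , inj₂ (inj₁ q))
    θ₃⇒block (inj₂ (inj₂ (inj₂ (inj₁ (p , q)))))    = inj₂ (inj₁ p , inj₂ (inj₁ q))
    θ₃⇒block (inj₂ (inj₂ (inj₂ (inj₂ (p , q)))))    = inj₂ (inj₂ (inj₁ p) , inj₁ q)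

    block⇒θ₃ : ∀ {u v} → Block Q S u v → θ₃ Q x y u v
    block⇒θ₃ (inj₁ e)                                           = inj₁ e
    block⇒θ₃ (inj₂ (inj₁ refl        , inj₁ refl))              = inj₁ refl
    block⇒θ₃ (inj₂ (inj₁ refl        , inj₂ (inj₁ refl)))       = inj₂ (inj₂ (inj₂ (inj₁ (refl , refl))))
    block⇒θ₃ (inj₂ (inj₁ refl        , inj₂ (inj₂ refl)))       = inj₂ (inj₁ (inj₁ (refl , refl)))
    block⇒θ₃ (inj₂ (inj₂ (inj₁ refl) , inj₁ refl))              = inj₂ (inj₂ (inj₂ (inj₂ (refl , refl))))
    block⇒θ₃ (inj₂ (inj₂ (inj₁ refl) , inj₂ (inj₁ refl)))       = inj₁ refl
    block⇒θ₃ (inj₂ (inj₂ (inj₁ refl) , inj₂ (inj₂ refl)))       = inj₂ (inj₂ (inj₁ (inj₁ (refl , y≡y*))))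
    block⇒θ₃ (inj₂ (inj₂ (inj₂ refl) , inj₁ refl))              = inj₂ (inj₁ (inj₂ (refl , refl)))
    block⇒θ₃ (inj₂ (inj₂ (inj₂ refl) , inj₂ (inj₁ refl)))       = inj₂ (inj₂ (inj₁ (inj₂ (y≡y* , refl))))
    block⇒θ₃ (inj₂ (inj₂ (inj₂ refl) , inj₂ (inj₂ refl)))       = inj₁ refl

  θ₄-isCongruence : IsCongruence Q (θ₄ Q x y)
  θ₄-isCongruence =
    isCongruence-resp-⇔ Q block⇒θ₄ θ₄⇒block (Block-isCongruence S *-closed)
    where
    S : Carrier → Set ℓ
    S u = u ≡ x ⊎ u ≡ x * ⊎ u ≡ y ⊎ u ≡ y *

    *-closed : ∀ {u} → S u → S (u *)
    *-closed (inj₁ refl)               = inj₂ (inj₁ refl)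
    *-closed (inj₂ (inj₁ refl))        = inj₁ (*-invol x)
    *-closed (inj₂ (inj₂ (inj₁ refl))) = inj₂ (inj₂ (inj₂ refl))
    *-closed (inj₂ (inj₂ (inj₂ refl))) = inj₂ (inj₂ (inj₁ (*-invol y)))

    pattern is-x  p = inj₁ p
    pattern is-x* p = inj₂ (inj₁ p)
    pattern is-y  p = inj₂ (inj₂ (inj₁ p))
    pattern is-y* p = inj₂ (inj₂ (inj₂ p))

    θ₄⇒block : ∀ {u v} → θ₄ Q x y u v → Block Q S u v
    θ₄⇒block (inj₁ e)                                                 = inj₁ e
    θ₄⇒block (inj₂ (inj₁ (inj₁ (p , q))))                             = inj₂ (is-x p , is-y q)
    θ₄⇒block (inj₂ (inj₁ (inj₂ (p , q))))                             = inj₂ (is-y p , is-x q)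
    θ₄⇒block (inj₂ (inj₂ (inj₁ (inj₁ (p , q)))))                      = inj₂ (is-x* p , is-y* q)
    θ₄⇒block (inj₂ (inj₂ (inj₁ (inj₂ (p , q)))))                      = inj₂ (is-y* p , is-x* q)
    θ₄⇒block (inj₂ (inj₂ (inj₂ (inj₁ (inj₁ (p , q))))))               = inj₂ (is-x p , is-x* q)
    θ₄⇒block (inj₂ (inj₂ (inj₂ (inj₁ (inj₂ (p , q))))))               = inj₂ (is-x* p , is-x q)
    θ₄⇒block (inj₂ (inj₂ (inj₂ (inj₂ (inj₁ (inj₁ (p , q)))))))        = inj₂ (is-y p , is-y* q)
    θ₄⇒block (inj₂ (inj₂ (inj₂ (inj₂ (inj₁ (inj₂ (p , q)))))))        = inj₂ (is-y* p , is-y q)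
    θ₄⇒block (inj₂ (inj₂ (inj₂ (inj₂ (inj₂ (inj₁ (inj₁ (p , q))))))))  = inj₂ (is-x p , is-y* q)
    θ₄⇒block (inj₂ (inj₂ (inj₂ (inj₂ (inj₂ (inj₁ (inj₂ (p , q))))))))  = inj₂ (is-y* p , is-x q)
    θ₄⇒block (inj₂ (inj₂ (inj₂ (inj₂ (inj₂ (inj₂ (inj₁ (p , q))))))))  = inj₂ (is-x* p , is-y q)
    θ₄⇒block (inj₂ (inj₂ (inj₂ (inj₂ (inj₂ (inj₂ (inj₂ (p , q))))))))  = inj₂ (is-y p , is-x* q)

    block⇒θ₄ : ∀ {u v} → Block Q S u v → θ₄ Q x y u v
    block⇒θ₄ (inj₁ e)                           = inj₁ e
    block⇒θ₄ (inj₂ (is-x refl  , is-x refl))    = inj₁ refl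
    block⇒θ₄ (inj₂ (is-x refl  , is-x* refl))   = inj₂ (inj₂ (inj₂ (inj₁ (inj₁ (refl , refl)))))
    block⇒θ₄ (inj₂ (is-x refl  , is-y refl))    = inj₂ (inj₁ (inj₁ (refl , refl)))
    block⇒θ₄ (inj₂ (is-x refl  , is-y* refl))   = inj₂ (inj₂ (inj₂ (inj₂ (inj₂ (inj₁ (inj₁ (refl , refl)))))))
    block⇒θ₄ (inj₂ (is-x* refl , is-x refl))    = inj₂ (inj₂ (inj₂ (inj₁ (inj₂ (refl , refl)))))
    block⇒θ₄ (inj₂ (is-x* refl , is-x* refl))   = inj₁ refl
    block⇒θ₄ (inj₂ (is-x* refl , is-y refl))    = inj₂ (inj₂ (inj₂ (inj₂ (inj₂ (inj₂ (inj₁ (refl , refl)))))))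
    block⇒θ₄ (inj₂ (is-x* refl , is-y* refl))   = inj₂ (inj₂ (inj₁ (inj₁ (refl , refl))))
    block⇒θ₄ (inj₂ (is-y refl  , is-x refl))    = inj₂ (inj₁ (inj₂ (refl , refl)))
    block⇒θ₄ (inj₂ (is-y refl  , is-x* refl))   = inj₂ (inj₂ (inj₂ (inj₂ (inj₂ (inj₂ (inj₂ (refl , refl)))))))
    block⇒θ₄ (inj₂ (is-y refl  , is-y refl))    = inj₁ refl
    block⇒θ₄ (inj₂ (is-y refl  , is-y* refl))   = inj₂ (inj₂ (inj₂ (inj₂ (inj₁ (inj₁ (refl , refl))))))
    block⇒θ₄ (inj₂ (is-y* refl , is-x refl))    = inj₂ (inj₂ (inj₂ (inj₂ (inj₂ (inj₁ (inj₂ (refl , refl)))))))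
    block⇒θ₄ (inj₂ (is-y* refl , is-x* refl))   = inj₂ (inj₂ (inj₁ (inj₂ (refl , refl))))
    block⇒θ₄ (inj₂ (is-y* refl , is-y refl))    = inj₂ (inj₂ (inj₂ (inj₂ (inj₁ (inj₂ (refl , refl))))))
    block⇒θ₄ (inj₂ (is-y* refl , is-y* refl))   = inj₁ refl

proposition5p13 : ∀ {ℓ : Level} (Q : QBAlgebra ℓ) → Flat Q → ∀ (x y : QBAlgebra.Carrier Q) → Irregular Q x → Irregular Q y → x ≢ y → ((x ≡ QBAlgebra._* Q x) → (y ≡ QBAlgebra._* Q y) → IsCongruence Q (θ₁ Q x y)) × ((x ≡ QBAlgebra._* Q x) → (y ≢ QBAlgebra._* Q y) → IsCongruence Q (θ₂ Q x y)) × ((x ≢ QBAlgebra._* Q x) → (y ≡ QBAlgebra._* Q y) → IsCongruence Q (θ₃ Q x y)) × ((x ≢ QBAlgebra._* Q x) → (y ≢ QBAlgebra._* Q y) → IsCongruence Q (θ₄ Q x y))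
proposition5p13 Q flat x y _ _ _ =
    θ₁-isCongruence
  , (λ x≡x* _ → θ₂-isCongruence x≡x*)
  , (λ _ y≡y* → θ₃-isCongruence y≡y*)
  , (λ _ _ → θ₄-isCongruence)
  where open Theta Q flat x y
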